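{- Let $r\ge4$. Any quasi product of $U_{2,3}$ and $M(r)$ has rank at most $2r-1$. In particular, no tensor product of $U_{2,3}$ and $M(r)$ exists.
   Context: For $r\ge4$, let $A,B,C,D$ be pairwise disjoint sets of size $r-2$. $M(r)$ is the rank-$r$ matroid on $A\cup B\cup C\cup D$ whose nonempty proper cyclic flats (flats that are unions of circuits) are exactly $A\cup B, A\cup C, A\cup D, B\cup C, B\cup D$, each of rank $r-1$ ($M(4)$ is the Vámos matroid). For matroids $M,N$, a matroid $P$ on $E(M)\times E(N)$ is a quasi product of $M$ and $N$ if: for every non-loop $e\in E(M)$, $x\mapsto(e,x)$ is an isomorphism $N\cong P|_{\{e\}\times E(N)}$; for every non-loop $f\in E(N)$, $x\mapsto(x,f)$ is an isomorphism $M\cong P|_{E(M)\times\{f\}}$; for loops $e$ of $M$ (resp. $f$ of $N$), $P|_{\{e\}\times E(N)}$ (resp. $P|_{E(M)\times\{f\}}$) has rank $0$. A tensor product is a quasi product of rank $\mathrm{rk}(M)\mathrm{rk}(N)$. -}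

module Defs where

open import Data.Nat using (ℕ; zero; suc; _+_; _*_; _∸_; _≤_; _<_; _⊓_)
open import Data.Bool using (Bool; true; false; _∧_; _∨_; if_then_else_)
open import Data.Fin using (Fin; zero; suc; combine; quotient; remainder)
import Data.Fin as Fin
open import Data.Fin.Subset using (Subset; _∈_; _∉_; _⊆_; _⊂_; _∪_; _∩_; ⁅_⁆; ⊤; ⊥; ∣_∣; Nonempty; _-_; inside; outside)
open import Data.Vec using (tabulate; lookup)
open import Data.Product using (Σ; ∃; _×_; _,_)
open import Data.Sum using (_⊎_)
open import Relation.Nullary using (¬_; does)
open import Relation.Binary.PropositionalEquality using (_≡_; _≢_)
open import Data.Nat using (_≤?_)
open import Data.Nat.Properties using (m⊓n≤n; ⊓-monoʳ-≤)
open import Data.Fin.Subset.Properties using (p⊆q⇒∣p∣≤∣q∣)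
open import Relation.Nullary.Decidable using (toWitness)
open import Data.Unit using (tt)
open import Data.Vec using (_∷_; [])

record Matroid (n : ℕ) : Set where
  field
    rk         : Subset n → ℕ
    rk-bounded : ∀ X → rk X ≤ ∣ X ∣
    rk-mono    : ∀ X Y → X ⊆ Y → rk X ≤ rk Y
    rk-submod  : ∀ X Y → rk (X ∪ Y) + rk (X ∩ Y) ≤ rk X + rk Y

open Matroid public

rank : ∀ {n} → Matroid n → ℕ
rank M = rk M ⊤

Independent : ∀ {n} → Matroid n → Subset n → Set
Independent M X = rk M X ≡ ∣ X ∣

Dependent : ∀ {n} → Matroid n → Subset n → Set
Dependent M X = rk M X < ∣ X ∣

IsCircuit : ∀ {n} → Matroid n → Subset n → Set
IsCircuit M C = Dependent M C × (∀ Y → Y ⊂ C → Independent M Y)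

IsFlat : ∀ {n} → Matroid n → Subset n → Set
IsFlat M X = ∀ e → e ∉ X → rk M X < rk M (X ∪ ⁅ e ⁆)

-- cyclic set = union of circuits: every element lies in a circuit inside X
IsCyclic : ∀ {n} → Matroid n → Subset n → Set
IsCyclic {n} M X = ∀ e → e ∈ X → Σ (Subset n) λ C → IsCircuit M C × e ∈ C × C ⊆ X

IsCyclicFlat : ∀ {n} → Matroid n → Subset n → Set
IsCyclicFlat M X = IsFlat M X × IsCyclic M X

IsLoop : ∀ {n} → Matroid n → Fin n → Set
IsLoop M e = rk M ⁅ e ⁆ ≡ 0

u23-submod : ∀ (X Y : Subset 3) → 2 ⊓ ∣ X ∪ Y ∣ + 2 ⊓ ∣ X ∩ Y ∣ ≤ 2 ⊓ ∣ X ∣ + 2 ⊓ ∣ Y ∣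
u23-submod (outside ∷ outside ∷ outside ∷ []) (outside ∷ outside ∷ outside ∷ []) = toWitness {a? = _ ≤? _} tt
u23-submod (outside ∷ outside ∷ outside ∷ []) (outside ∷ outside ∷ inside ∷ []) = toWitness {a? = _ ≤? _} tt
u23-submod (outside ∷ outside ∷ outside ∷ []) (outside ∷ inside ∷ outside ∷ []) = toWitness {a? = _ ≤? _} tt
u23-submod (outside ∷ outside ∷ outside ∷ []) (outside ∷ inside ∷ inside ∷ []) = toWitness {a? = _ ≤? _} tt
u23-submod (outside ∷ outside ∷ outside ∷ []) (inside ∷ outside ∷ outside ∷ []) = toWitness {a? = _ ≤? _} tt
u23-submod (outside ∷ outside ∷ outside ∷ []) (inside ∷ outside ∷ inside ∷ []) = toWitness {a? = _ ≤? _} tt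
u23-submod (outside ∷ outside ∷ outside ∷ []) (inside ∷ inside ∷ outside ∷ []) = toWitness {a? = _ ≤? _} tt
u23-submod (outside ∷ outside ∷ outside ∷ []) (inside ∷ inside ∷ inside ∷ []) = toWitness {a? = _ ≤? _} tt
u23-submod (outside ∷ outside ∷ inside ∷ []) (outside ∷ outside ∷ outside ∷ []) = toWitness {a? = _ ≤? _} tt
u23-submod (outside ∷ outside ∷ inside ∷ []) (outside ∷ outside ∷ inside ∷ []) = toWitness {a? = _ ≤? _} tt
u23-submod (outside ∷ outside ∷ inside ∷ []) (outside ∷ inside ∷ outside ∷ []) = toWitness {a? = _ ≤? _} tt
u23-submod (outside ∷ outside ∷ inside ∷ []) (outside ∷ inside ∷ inside ∷ []) = toWitness {a? = _ ≤? _} tt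
u23-submod (outside ∷ outside ∷ inside ∷ []) (inside ∷ outside ∷ outside ∷ []) = toWitness {a? = _ ≤? _} tt
u23-submod (outside ∷ outside ∷ inside ∷ []) (inside ∷ outside ∷ inside ∷ []) = toWitness {a? = _ ≤? _} tt
u23-submod (outside ∷ outside ∷ inside ∷ []) (inside ∷ inside ∷ outside ∷ []) = toWitness {a? = _ ≤? _} tt
u23-submod (outside ∷ outside ∷ inside ∷ []) (inside ∷ inside ∷ inside ∷ []) = toWitness {a? = _ ≤? _} tt
u23-submod (outside ∷ inside ∷ outside ∷ []) (outside ∷ outside ∷ outside ∷ []) = toWitness {a? = _ ≤? _} tt
u23-submod (outside ∷ inside ∷ outside ∷ []) (outside ∷ outside ∷ inside ∷ []) = toWitness {a? = _ ≤? _} tt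
u23-submod (outside ∷ inside ∷ outside ∷ []) (outside ∷ inside ∷ outside ∷ []) = toWitness {a? = _ ≤? _} tt
u23-submod (outside ∷ inside ∷ outside ∷ []) (outside ∷ inside ∷ inside ∷ []) = toWitness {a? = _ ≤? _} tt
u23-submod (outside ∷ inside ∷ outside ∷ []) (inside ∷ outside ∷ outside ∷ []) = toWitness {a? = _ ≤? _} tt
u23-submod (outside ∷ inside ∷ outside ∷ []) (inside ∷ outside ∷ inside ∷ []) = toWitness {a? = _ ≤? _} tt
u23-submod (outside ∷ inside ∷ outside ∷ []) (inside ∷ inside ∷ outside ∷ []) = toWitness {a? = _ ≤? _} tt
u23-submod (outside ∷ inside ∷ outside ∷ []) (inside ∷ inside ∷ inside ∷ []) = toWitness {a? = _ ≤? _} tt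
u23-submod (outside ∷ inside ∷ inside ∷ []) (outside ∷ outside ∷ outside ∷ []) = toWitness {a? = _ ≤? _} tt
u23-submod (outside ∷ inside ∷ inside ∷ []) (outside ∷ outside ∷ inside ∷ []) = toWitness {a? = _ ≤? _} tt
u23-submod (outside ∷ inside ∷ inside ∷ []) (outside ∷ inside ∷ outside ∷ []) = toWitness {a? = _ ≤? _} tt
u23-submod (outside ∷ inside ∷ inside ∷ []) (outside ∷ inside ∷ inside ∷ []) = toWitness {a? = _ ≤? _} tt
u23-submod (outside ∷ inside ∷ inside ∷ []) (inside ∷ outside ∷ outside ∷ []) = toWitness {a? = _ ≤? _} tt
u23-submod (outside ∷ inside ∷ inside ∷ []) (inside ∷ outside ∷ inside ∷ []) = toWitness {a? = _ ≤? _} tt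
u23-submod (outside ∷ inside ∷ inside ∷ []) (inside ∷ inside ∷ outside ∷ []) = toWitness {a? = _ ≤? _} tt
u23-submod (outside ∷ inside ∷ inside ∷ []) (inside ∷ inside ∷ inside ∷ []) = toWitness {a? = _ ≤? _} tt
u23-submod (inside ∷ outside ∷ outside ∷ []) (outside ∷ outside ∷ outside ∷ []) = toWitness {a? = _ ≤? _} tt
u23-submod (inside ∷ outside ∷ outside ∷ []) (outside ∷ outside ∷ inside ∷ []) = toWitness {a? = _ ≤? _} tt
u23-submod (inside ∷ outside ∷ outside ∷ []) (outside ∷ inside ∷ outside ∷ []) = toWitness {a? = _ ≤? _} tt
u23-submod (inside ∷ outside ∷ outside ∷ []) (outside ∷ inside ∷ inside ∷ []) = toWitness {a? = _ ≤? _} tt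
u23-submod (inside ∷ outside ∷ outside ∷ []) (inside ∷ outside ∷ outside ∷ []) = toWitness {a? = _ ≤? _} tt
u23-submod (inside ∷ outside ∷ outside ∷ []) (inside ∷ outside ∷ inside ∷ []) = toWitness {a? = _ ≤? _} tt
u23-submod (inside ∷ outside ∷ outside ∷ []) (inside ∷ inside ∷ outside ∷ []) = toWitness {a? = _ ≤? _} tt
u23-submod (inside ∷ outside ∷ outside ∷ []) (inside ∷ inside ∷ inside ∷ []) = toWitness {a? = _ ≤? _} tt
u23-submod (inside ∷ outside ∷ inside ∷ []) (outside ∷ outside ∷ outside ∷ []) = toWitness {a? = _ ≤? _} tt
u23-submod (inside ∷ outside ∷ inside ∷ []) (outside ∷ outside ∷ inside ∷ []) = toWitness {a? = _ ≤? _} tt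
u23-submod (inside ∷ outside ∷ inside ∷ []) (outside ∷ inside ∷ outside ∷ []) = toWitness {a? = _ ≤? _} tt
u23-submod (inside ∷ outside ∷ inside ∷ []) (outside ∷ inside ∷ inside ∷ []) = toWitness {a? = _ ≤? _} tt
u23-submod (inside ∷ outside ∷ inside ∷ []) (inside ∷ outside ∷ outside ∷ []) = toWitness {a? = _ ≤? _} tt
u23-submod (inside ∷ outside ∷ inside ∷ []) (inside ∷ outside ∷ inside ∷ []) = toWitness {a? = _ ≤? _} tt
u23-submod (inside ∷ outside ∷ inside ∷ []) (inside ∷ inside ∷ outside ∷ []) = toWitness {a? = _ ≤? _} tt
u23-submod (inside ∷ outside ∷ inside ∷ []) (inside ∷ inside ∷ inside ∷ []) = toWitness {a? = _ ≤? _} tt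
u23-submod (inside ∷ inside ∷ outside ∷ []) (outside ∷ outside ∷ outside ∷ []) = toWitness {a? = _ ≤? _} tt
u23-submod (inside ∷ inside ∷ outside ∷ []) (outside ∷ outside ∷ inside ∷ []) = toWitness {a? = _ ≤? _} tt
u23-submod (inside ∷ inside ∷ outside ∷ []) (outside ∷ inside ∷ outside ∷ []) = toWitness {a? = _ ≤? _} tt
u23-submod (inside ∷ inside ∷ outside ∷ []) (outside ∷ inside ∷ inside ∷ []) = toWitness {a? = _ ≤? _} tt
u23-submod (inside ∷ inside ∷ outside ∷ []) (inside ∷ outside ∷ outside ∷ []) = toWitness {a? = _ ≤? _} tt
u23-submod (inside ∷ inside ∷ outside ∷ []) (inside ∷ outside ∷ inside ∷ []) = toWitness {a? = _ ≤? _} tt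
u23-submod (inside ∷ inside ∷ outside ∷ []) (inside ∷ inside ∷ outside ∷ []) = toWitness {a? = _ ≤? _} tt
u23-submod (inside ∷ inside ∷ outside ∷ []) (inside ∷ inside ∷ inside ∷ []) = toWitness {a? = _ ≤? _} tt
u23-submod (inside ∷ inside ∷ inside ∷ []) (outside ∷ outside ∷ outside ∷ []) = toWitness {a? = _ ≤? _} tt
u23-submod (inside ∷ inside ∷ inside ∷ []) (outside ∷ outside ∷ inside ∷ []) = toWitness {a? = _ ≤? _} tt
u23-submod (inside ∷ inside ∷ inside ∷ []) (outside ∷ inside ∷ outside ∷ []) = toWitness {a? = _ ≤? _} tt
u23-submod (inside ∷ inside ∷ inside ∷ []) (outside ∷ inside ∷ inside ∷ []) = toWitness {a? = _ ≤? _} tt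
u23-submod (inside ∷ inside ∷ inside ∷ []) (inside ∷ outside ∷ outside ∷ []) = toWitness {a? = _ ≤? _} tt
u23-submod (inside ∷ inside ∷ inside ∷ []) (inside ∷ outside ∷ inside ∷ []) = toWitness {a? = _ ≤? _} tt
u23-submod (inside ∷ inside ∷ inside ∷ []) (inside ∷ inside ∷ outside ∷ []) = toWitness {a? = _ ≤? _} tt
u23-submod (inside ∷ inside ∷ inside ∷ []) (inside ∷ inside ∷ inside ∷ []) = toWitness {a? = _ ≤? _} tt

U23 : Matroid 3
U23 = record
  { rk = λ X → 2 ⊓ ∣ X ∣
  ; rk-bounded = λ X → m⊓n≤n 2 ∣ X ∣
  ; rk-mono = λ X Y p → ⊓-monoʳ-≤ 2 (p⊆q⇒∣p∣≤∣q∣ p)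
  ; rk-submod = u23-submod
  }

-- Product ground sets: E(M) × E(N) is encoded as Fin (m * n) via
-- Data.Fin.combine (with inverse quotient / remainder).

-- image of X ⊆ E(N) under x ↦ (e , x)
rowSet : ∀ {m n} → Fin m → Subset n → Subset (m * n)
rowSet {m} {n} e X =
  tabulate λ j → does (quotient {m} n j Fin.≟ e) ∧ lookup X (remainder {m} n j)

-- image of Y ⊆ E(M) under x ↦ (x , f)
colSet : ∀ {m n} → Fin n → Subset m → Subset (m * n)
colSet {m} {n} f Y =
  tabulate λ j → does (remainder {m} n j Fin.≟ f) ∧ lookup Y (quotient {m} n j)

IsQuasiProduct : ∀ {m n} → Matroid m → Matroid n → Matroid (m * n) → Set
IsQuasiProduct {m} {n} M N P =
    (∀ e → ¬ IsLoop M e → ∀ X → rk N X ≡ rk P (rowSet e X))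
  × (∀ f → ¬ IsLoop N f → ∀ Y → rk M Y ≡ rk P (colSet f Y))
  × (∀ e → IsLoop M e → rk P (rowSet {m} e ⊤) ≡ 0)
  × (∀ f → IsLoop N f → rk P (colSet {m} f ⊤) ≡ 0)

IsTensorProduct : ∀ {m n} → Matroid m → Matroid n → Matroid (m * n) → Set
IsTensorProduct M N P = IsQuasiProduct M N P × rank P ≡ rank M * rank N

-- The matroid M(r).  Ground set Fin (4 * (r ∸ 2)), split into the four
-- blocks A = block 0, B = block 1, C = block 2, D = block 3, each of
-- size r - 2 (block i = elements j with quotient j = i).

block : ∀ k → Fin 4 → Subset (4 * k)
block k i = tabulate λ j → does (quotient {4} k j Fin.≟ i)

blockA blockB blockC blockD : ∀ k → Subset (4 * k)
blockA k = block k zero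
blockB k = block k (suc zero)
blockC k = block k (suc (suc zero))
blockD k = block k (suc (suc (suc zero)))

IsDistinguished : ∀ k → Subset (4 * k) → Set
IsDistinguished k X =
    X ≡ blockA k ∪ blockB k
  ⊎ X ≡ blockA k ∪ blockC k
  ⊎ X ≡ blockA k ∪ blockD k
  ⊎ X ≡ blockB k ∪ blockC k
  ⊎ X ≡ blockB k ∪ blockD k

IsMr : (r : ℕ) → Matroid (4 * (r ∸ 2)) → Set
IsMr r N =
    rank N ≡ r
  × (∀ X → (Nonempty X × X ≢ ⊤ × IsCyclicFlat N X) → IsDistinguished (r ∸ 2) X)
  × (∀ X → IsDistinguished (r ∸ 2) X → Nonempty X × X ≢ ⊤ × IsCyclicFlat N X)
  × (∀ X → IsDistinguished (r ∸ 2) X → rk N X ≡ r ∸ 1)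

-- Let P be a quasi product of U₂,₃ and a matroid N with rk P ≥ 2 rk N. Every column of P is a
-- copy of U₂,₃ (or consists of loops), so any two rows of P span the third; hence any two rows
-- are skew and each has rank rk N. Put K = row₀ A ∪ row₁ B and φ Z = rk (K ∪ row₂ Z). Comparing
-- φ with ranks in N by submodularity of rk P gives, for all A B C D ⊆ E(N),
--   rk A + rk B + rk (A∪B∪C) + rk (A∪B∪D) + rk (C∪D) ≤ rk (A∪B) + rk (A∪C) + rk (A∪D) + rk (B∪C) + rk (B∪D),
-- Ingleton's inequality. M(r) violates it: the blocks A, B have rank r - 2, the sets A∪B∪C,
-- A∪B∪D, C∪D have rank r and the five distinguished sets rank r - 1. So rk P < 2r, while a
-- tensor product would have rank exactly 2r. The lower bounds in M(r) come from
-- rk X = min { rk F + |X - F| : F cyclic flat }.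

module Submission where

open import Data.Bool using (Bool; true; _∧_)
import Data.Bool.Properties as Boolₚ
open import Data.Empty using (⊥-elim)
open import Data.Fin using (Fin; zero; suc; _≟_; combine; quotient; remainder)
open import Data.Fin.Properties using (any?; remQuot-combine; combine-injectiveʳ)
import Data.Fin.Properties as Finₚ
open import Data.Fin.Subset
  using (Subset; _∈_; _∉_; _⊆_; _⊂_; _∪_; _∩_; _─_; _-_; ⁅_⁆; ⊤; ⊥; ∣_∣; Nonempty; inside; outside)
open import Data.Fin.Subset.Properties
open import Data.Nat using (ℕ; zero; suc; _+_; _*_; _∸_; _≤_; _<_; z≤n; s≤s; _≤?_; _<?_)
  renaming (_≟_ to _≟ℕ_)
open import Data.Nat.Properties hiding (_≟_)
open import Data.Nat.Tactic.RingSolver using (solve-∀)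
open import Data.Product using (∃; _×_; _,_; proj₁; proj₂)
open import Data.Sum using (inj₁; inj₂; [_,_])
open import Data.Vec using ([]; _∷_; here; there; tabulate)
open import Data.Vec.Properties using ([]=⇒lookup; lookup⇒[]=; lookup∘tabulate; ≡-dec)
open import Relation.Nullary using (¬_; Dec; yes; no; does; contradiction)
open import Relation.Nullary.Decidable using (_×-dec_; dec-true)
open import Relation.Binary.PropositionalEquality
  using (_≡_; _≢_; refl; sym; trans; cong; cong₂; subst; subst₂)

open import Defs

∪-least : ∀ {n} {p q s : Subset n} → p ⊆ s → q ⊆ s → p ∪ q ⊆ s
∪-least {p = p} {q} p⊆s q⊆s x∈p∪q = [ p⊆s , q⊆s ] (x∈p∪q⁻ p q x∈p∪q)

∩-greatest : ∀ {n} {p q s : Subset n} → s ⊆ p → s ⊆ q → s ⊆ p ∩ q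
∩-greatest s⊆p s⊆q x∈s = x∈p∩q⁺ (s⊆p x∈s , s⊆q x∈s)

∪-mono : ∀ {n} {p p′ q q′ : Subset n} → p ⊆ p′ → q ⊆ q′ → p ∪ q ⊆ p′ ∪ q′
∪-mono {p′ = p′} {q′ = q′} p⊆p′ q⊆q′ =
  ∪-least (λ x∈p → p⊆p∪q q′ (p⊆p′ x∈p)) (λ x∈q → q⊆p∪q p′ q′ (q⊆q′ x∈q))

x∈p─q⇒x∉q : ∀ {n} {x : Fin n} (p q : Subset n) → x ∈ p ─ q → x ∉ q
x∈p─q⇒x∉q (_ ∷ _)      (inside ∷ _)  ()     here
x∈p─q⇒x∉q (inside ∷ _) (outside ∷ _) here   ()
x∈p─q⇒x∉q (_ ∷ p)      (_ ∷ q)       (there x∈) (there x∈q) = x∈p─q⇒x∉q p q x∈ x∈q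

x∈p-y⇒x∈p : ∀ {n} {x y : Fin n} (p : Subset n) → x ∈ p - y → x ∈ p
x∈p-y⇒x∈p {y = y} p = p─q⊆p p ⁅ y ⁆

x∈p-y⇒x≢y : ∀ {n} {x y : Fin n} (p : Subset n) → x ∈ p - y → x ≢ y
x∈p-y⇒x≢y {y = y} p x∈ refl = x∈p─q⇒x∉q p ⁅ y ⁆ x∈ (x∈⁅x⁆ y)

p⊆p-x∪⁅x⁆ : ∀ {n} (p : Subset n) x → p ⊆ (p - x) ∪ ⁅ x ⁆
p⊆p-x∪⁅x⁆ p x {y} y∈p with y ≟ x
... | yes refl = q⊆p∪q (p - x) ⁅ x ⁆ (x∈⁅x⁆ x)
... | no  y≢x  = p⊆p∪q ⁅ x ⁆ (x∈p∧x≢y⇒x∈p-y y∈p y≢x)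

x∈p⇒⁅x⁆⊆p : ∀ {n} {x : Fin n} {p : Subset n} → x ∈ p → ⁅ x ⁆ ⊆ p
x∈p⇒⁅x⁆⊆p {x = x} {p} x∈p y∈⁅x⁆ = subst (_∈ p) (sym (x∈⁅y⁆⇒x≡y x y∈⁅x⁆)) x∈p

⊆-∪⁅x⁆-∉ : ∀ {n} {x : Fin n} {p q : Subset n} → q ⊆ p ∪ ⁅ x ⁆ → x ∉ q → q ⊆ p
⊆-∪⁅x⁆-∉ {x = x} {p} q⊆ x∉q {y} y∈q with x∈p∪q⁻ p ⁅ x ⁆ (q⊆ y∈q)
... | inj₁ y∈p   = y∈p
... | inj₂ y∈⁅x⁆ = contradiction (subst (_∈ _) (x∈⁅y⁆⇒x≡y x y∈⁅x⁆) y∈q) x∉q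

∣Empty∣≡0 : ∀ {n} {p : Subset n} → ¬ Nonempty p → ∣ p ∣ ≡ 0
∣Empty∣≡0 {n} p-empty = trans (cong ∣_∣ (Empty-unique p-empty)) (∣⊥∣≡0 n)

∣p─p∣≡0 : ∀ {n} (p : Subset n) → ∣ p ─ p ∣ ≡ 0
∣p─p∣≡0 p = ∣Empty∣≡0 λ (x , x∈) → x∈p─q⇒x∉q p p x∈ (p─q⊆p p p x∈)

∣p∩q∣+∣p─q∣≡∣p∣ : ∀ {n} (p q : Subset n) → ∣ p ∩ q ∣ + ∣ p ─ q ∣ ≡ ∣ p ∣
∣p∩q∣+∣p─q∣≡∣p∣ []           []            = refl
∣p∩q∣+∣p─q∣≡∣p∣ (inside ∷ p)  (inside ∷ q)  = cong suc (∣p∩q∣+∣p─q∣≡∣p∣ p q)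
∣p∩q∣+∣p─q∣≡∣p∣ (inside ∷ p)  (outside ∷ q) = trans (+-suc _ _) (cong suc (∣p∩q∣+∣p─q∣≡∣p∣ p q))
∣p∩q∣+∣p─q∣≡∣p∣ (outside ∷ p) (inside ∷ q)  = ∣p∩q∣+∣p─q∣≡∣p∣ p q
∣p∩q∣+∣p─q∣≡∣p∣ (outside ∷ p) (outside ∷ q) = ∣p∩q∣+∣p─q∣≡∣p∣ p q

∣p∪q∣+∣p∩q∣≡∣p∣+∣q∣ : ∀ {n} (p q : Subset n) → ∣ p ∪ q ∣ + ∣ p ∩ q ∣ ≡ ∣ p ∣ + ∣ q ∣
∣p∪q∣+∣p∩q∣≡∣p∣+∣q∣ []            []            = refl
∣p∪q∣+∣p∩q∣≡∣p∣+∣q∣ (inside ∷ p)  (inside ∷ q)  =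
  cong suc (trans (+-suc _ _) (trans (cong suc (∣p∪q∣+∣p∩q∣≡∣p∣+∣q∣ p q)) (sym (+-suc _ _))))
∣p∪q∣+∣p∩q∣≡∣p∣+∣q∣ (inside ∷ p)  (outside ∷ q) = cong suc (∣p∪q∣+∣p∩q∣≡∣p∣+∣q∣ p q)
∣p∪q∣+∣p∩q∣≡∣p∣+∣q∣ (outside ∷ p) (inside ∷ q)  = trans (cong suc (∣p∪q∣+∣p∩q∣≡∣p∣+∣q∣ p q)) (sym (+-suc _ _))
∣p∪q∣+∣p∩q∣≡∣p∣+∣q∣ (outside ∷ p) (outside ∷ q) = ∣p∪q∣+∣p∩q∣≡∣p∣+∣q∣ p q

∣p∪⁅x⁆∣≡1+∣p∣ : ∀ {n} {x : Fin n} (p : Subset n) → x ∉ p → ∣ p ∪ ⁅ x ⁆ ∣ ≡ suc ∣ p ∣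
∣p∪⁅x⁆∣≡1+∣p∣ {x = zero}  (inside ∷ p)  x∉p = contradiction here x∉p
∣p∪⁅x⁆∣≡1+∣p∣ {x = zero}  (outside ∷ p) _   = cong (λ q → suc ∣ q ∣) (∪-identityʳ p)
∣p∪⁅x⁆∣≡1+∣p∣ {x = suc x} (inside ∷ p)  x∉p = cong suc (∣p∪⁅x⁆∣≡1+∣p∣ p (λ x∈p → x∉p (there x∈p)))
∣p∪⁅x⁆∣≡1+∣p∣ {x = suc x} (outside ∷ p) x∉p = ∣p∪⁅x⁆∣≡1+∣p∣ p (λ x∈p → x∉p (there x∈p))

∣p∣≤1+∣p-x∣ : ∀ {n} (p : Subset n) x → ∣ p ∣ ≤ suc ∣ p - x ∣
∣p∣≤1+∣p-x∣ (inside ∷ p)  zero    = s≤s (≤-reflexive (cong ∣_∣ (sym (p─⊥≡p p))))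
∣p∣≤1+∣p-x∣ (outside ∷ p) zero    = m≤n⇒m≤1+n (≤-reflexive (cong ∣_∣ (sym (p─⊥≡p p))))
∣p∣≤1+∣p-x∣ (inside ∷ p)  (suc x) = s≤s (∣p∣≤1+∣p-x∣ p x)
∣p∣≤1+∣p-x∣ (outside ∷ p) (suc x) = ∣p∣≤1+∣p-x∣ p x

injection⇒≤∣p∣ : ∀ {m n} {p : Subset n} (f : Fin m → Fin n)
  → (∀ {x y} → f x ≡ f y → x ≡ y) → (∀ x → f x ∈ p) → m ≤ ∣ p ∣
injection⇒≤∣p∣ {zero}      f f-inj f∈p = z≤n
injection⇒≤∣p∣ {suc m} {p = p} f f-inj f∈p = ≤-trans
  (s≤s (injection⇒≤∣p∣ {p = p - f zero} (λ x → f (suc x))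
         (λ eq → Finₚ.suc-injective (f-inj eq))
         (λ x → x∈p∧x≢y⇒x∈p-y (f∈p (suc x)) (λ eq → Finₚ.0≢1+n (sym (f-inj eq))))))
  (x∈p⇒∣p-x∣<∣p∣ (f∈p zero))

removal-induction : ∀ {n} (P : Subset n → Set)
  → (∀ S → (∀ {x} → x ∈ S → P (S - x)) → P S) → ∀ S → P S
removal-induction P step S = go ∣ S ∣ S ≤-refl
  where
  go : ∀ k S → ∣ S ∣ ≤ k → P S
  go zero    S ∣S∣≤0 = step S λ x∈S → ⊥-elim (n≮0 (<-≤-trans (x∈p⇒∣p-x∣<∣p∣ x∈S) ∣S∣≤0))
  go (suc k) S ∣S∣≤k = step S λ x∈S → go k _ (≤-pred (<-≤-trans (x∈p⇒∣p-x∣<∣p∣ x∈S) ∣S∣≤k))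

∈-tabulate⁻ : ∀ {n} (g : Fin n → Bool) {x} → x ∈ tabulate g → g x ≡ true
∈-tabulate⁻ g {x} x∈ = trans (sym (lookup∘tabulate g x)) ([]=⇒lookup x∈)

∈-tabulate⁺ : ∀ {n} (g : Fin n → Bool) {x} → g x ≡ true → x ∈ tabulate g
∈-tabulate⁺ g {x} gx≡true = lookup⇒[]= x (tabulate g) (trans (lookup∘tabulate g x) gx≡true)

dec-true⁻ : ∀ {A : Set} (a? : Dec A) → does a? ≡ true → A
dec-true⁻ (yes a) _ = a

module Rank {n} (M : Matroid n) where

  r : Subset n → ℕ
  r = rk M

  mono : ∀ {X Y} → X ⊆ Y → r X ≤ r Y
  mono = rk-mono M _ _

  submod-⊆ : ∀ {X Y U I} → U ⊆ X ∪ Y → I ⊆ X ∩ Y → r U + r I ≤ r X + r Y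
  submod-⊆ {X} {Y} U⊆ I⊆ = ≤-trans (+-mono-≤ (mono U⊆) (mono I⊆)) (rk-submod M X Y)

  subadditive : ∀ {X Y U} → U ⊆ X ∪ Y → r U ≤ r X + r Y
  subadditive {U = U} U⊆ = ≤-trans (m≤m+n (r U) (r ⊥)) (submod-⊆ U⊆ ⊥⊆)

  -- closure is monotone: S′ ⊆ cl S and S ⊆ T give T ∪ S′ ⊆ cl T
  spanned-⊆ : ∀ {S S′ T U} → S ⊆ T → S ⊆ S′ → r S′ ≤ r S → U ⊆ T ∪ S′ → r U ≤ r T
  spanned-⊆ {S} {S′} {T} {U} S⊆T S⊆S′ rS′≤rS U⊆ = +-cancelʳ-≤ (r S) (r U) (r T) (begin
    r U + r S  ≤⟨ submod-⊆ U⊆ (∩-greatest S⊆T S⊆S′) ⟩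
    r T + r S′ ≤⟨ +-monoʳ-≤ (r T) rS′≤rS ⟩
    r T + r S  ∎)
    where open ≤-Reasoning

  ∪-spanned : ∀ T S → (∀ {e} → e ∈ S → r (T ∪ ⁅ e ⁆) ≤ r T) → r (T ∪ S) ≤ r T
  ∪-spanned T = removal-induction Spanned step
    where
    Spanned : Subset n → Set
    Spanned S = (∀ {e} → e ∈ S → r (T ∪ ⁅ e ⁆) ≤ r T) → r (T ∪ S) ≤ r T

    step : ∀ S → (∀ {x} → x ∈ S → Spanned (S - x)) → Spanned S
    step S ih spans with nonempty? S
    ... | no  S-empty   = mono (∪-least ⊆-refl (λ x∈S → ⊥-elim (S-empty (_ , x∈S))))
    ... | yes (e , e∈S) = ≤-trans
      (spanned-⊆ (p⊆p∪q (S - e)) (p⊆p∪q ⁅ e ⁆) (spans e∈S)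
        (∪-least (λ x∈T → p⊆p∪q (T ∪ ⁅ e ⁆) (p⊆p∪q (S - e) x∈T))
                 (λ x∈S → ∪-mono (q⊆p∪q T (S - e)) (q⊆p∪q T ⁅ e ⁆) (p⊆p-x∪⁅x⁆ S e x∈S))))
      (ih e∈S (λ x∈S-e → spans (x∈p-y⇒x∈p S x∈S-e)))

  skew-⊆ : ∀ {S S′ T T′} → S ⊆ S′ → T ⊆ T′
    → r (S′ ∪ T′) + (r S + r T) ≤ r (S ∪ T) + (r S′ + r T′)
  skew-⊆ {S} {S′} {T} {T′} S⊆S′ T⊆T′ = begin
    r (S′ ∪ T′) + (r S + r T)   ≡⟨ +-assoc (r (S′ ∪ T′)) (r S) (r T) ⟨
    r (S′ ∪ T′) + r S + r T     ≤⟨ +-monoˡ-≤ (r T) S-step ⟩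
    r S′ + r (S ∪ T′) + r T     ≡⟨ +-assoc (r S′) (r (S ∪ T′)) (r T) ⟩
    r S′ + (r (S ∪ T′) + r T)   ≤⟨ +-monoʳ-≤ (r S′) T-step ⟩
    r S′ + (r T′ + r (S ∪ T))   ≡⟨ +-assoc (r S′) (r T′) (r (S ∪ T)) ⟨
    r S′ + r T′ + r (S ∪ T)     ≡⟨ +-comm (r S′ + r T′) (r (S ∪ T)) ⟩
    r (S ∪ T) + (r S′ + r T′)   ∎
    where
    open ≤-Reasoning
    S-step : r (S′ ∪ T′) + r S ≤ r S′ + r (S ∪ T′)
    S-step = submod-⊆ (∪-mono ⊆-refl (q⊆p∪q S T′)) (∩-greatest S⊆S′ (p⊆p∪q T′))
    T-step : r (S ∪ T′) + r T ≤ r T′ + r (S ∪ T)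
    T-step = submod-⊆ (∪-least (λ x∈S → q⊆p∪q T′ (S ∪ T) (p⊆p∪q T x∈S)) (p⊆p∪q (S ∪ T)))
                      (∩-greatest T⊆T′ (q⊆p∪q S T))

  indep-⊆ : ∀ {S T} → ∣ S ∣ ≤ r S → T ⊆ S → ∣ T ∣ ≤ r T
  indep-⊆ {S} {T} indep T⊆S = +-cancelʳ-≤ ∣ S ─ T ∣ ∣ T ∣ (r T) (begin
    ∣ T ∣ + ∣ S ─ T ∣      ≤⟨ +-monoˡ-≤ ∣ S ─ T ∣ (p⊆q⇒∣p∣≤∣q∣ (∩-greatest T⊆S ⊆-refl)) ⟩
    ∣ S ∩ T ∣ + ∣ S ─ T ∣  ≡⟨ ∣p∩q∣+∣p─q∣≡∣p∣ S T ⟩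
    ∣ S ∣                  ≤⟨ indep ⟩
    r S                    ≤⟨ subadditive S⊆T∪S─T ⟩
    r T + r (S ─ T)        ≤⟨ +-monoʳ-≤ (r T) (rk-bounded M (S ─ T)) ⟩
    r T + ∣ S ─ T ∣        ∎)
    where
    open ≤-Reasoning
    S⊆T∪S─T : S ⊆ T ∪ (S ─ T)
    S⊆T∪S─T {x} x∈S with x ∈? T
    ... | yes x∈T = p⊆p∪q (S ─ T) x∈T
    ... | no  x∉T = q⊆p∪q T (S ─ T) (x∈p∧x∉q⇒x∈p─q x∈S x∉T)

  coloop-⊆ : ∀ {S T x} → T ⊆ S → x ∈ T → r (S - x) < r S → r (T - x) < r T
  coloop-⊆ {S} {T} {x} T⊆S x∈T coloop = +-cancelˡ-< (r (S - x)) (r (T - x)) (r T) (begin-strict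
    r (S - x) + r (T - x)  <⟨ +-monoˡ-< (r (T - x)) coloop ⟩
    r S + r (T - x)        ≤⟨ submod-⊆ S⊆ T-x⊆ ⟩
    r T + r (S - x)        ≡⟨ +-comm (r T) (r (S - x)) ⟩
    r (S - x) + r T        ∎)
    where
    open ≤-Reasoning
    S⊆ : S ⊆ T ∪ (S - x)
    S⊆ y∈S = ∪-least (q⊆p∪q T (S - x)) (λ y∈⁅x⁆ → p⊆p∪q (S - x) (x∈p⇒⁅x⁆⊆p x∈T y∈⁅x⁆))
                     (p⊆p-x∪⁅x⁆ S x y∈S)
    T-x⊆ : T - x ⊆ T ∩ (S - x)
    T-x⊆ y∈ = x∈p∩q⁺ (x∈p-y⇒x∈p T y∈ , x∈p∧x≢y⇒x∈p-y (T⊆S (x∈p-y⇒x∈p T y∈)) (x∈p-y⇒x≢y T y∈))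

  coloops⇒indep : ∀ S → (∀ {x} → x ∈ S → r (S - x) < r S) → ∣ S ∣ ≤ r S
  coloops⇒indep S coloops = removal-induction (λ T → T ⊆ S → ∣ T ∣ ≤ r T) step S ⊆-refl
    where
    open ≤-Reasoning
    step : ∀ T → (∀ {x} → x ∈ T → T - x ⊆ S → ∣ T - x ∣ ≤ r (T - x)) → T ⊆ S → ∣ T ∣ ≤ r T
    step T ih T⊆S with nonempty? T
    ... | no  T-empty        = ≤-trans (≤-reflexive (∣Empty∣≡0 T-empty)) z≤n
    ... | yes (x , x∈T) = begin
      ∣ T ∣            ≤⟨ ∣p∣≤1+∣p-x∣ T x ⟩
      suc ∣ T - x ∣    ≤⟨ s≤s (ih x∈T (λ y∈ → T⊆S (x∈p-y⇒x∈p T y∈))) ⟩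
      suc (r (T - x))  ≤⟨ coloop-⊆ T⊆S x∈T (coloops (T⊆S x∈T)) ⟩
      r T              ∎

  ≤⇒Independent : ∀ {X} → ∣ X ∣ ≤ r X → Independent M X
  ≤⇒Independent {X} = ≤-antisym (rk-bounded M X)

  minimal-spanning⇒circuit : ∀ S {e} → e ∉ S → r (S ∪ ⁅ e ⁆) ≤ r S
    → (∀ {x} → x ∈ S → r (S - x) < r ((S - x) ∪ ⁅ e ⁆))
    → IsCircuit M (S ∪ ⁅ e ⁆)
  minimal-spanning⇒circuit S {e} e∉S spanned minimal = dependent , proper-indep
    where
    open ≤-Reasoning
    S-indep : ∣ S ∣ ≤ r S
    S-indep = coloops⇒indep S λ {x} x∈S → begin-strict
      r (S - x)              <⟨ minimal x∈S ⟩
      r ((S - x) ∪ ⁅ e ⁆)    ≤⟨ mono (∪-mono (x∈p-y⇒x∈p S) ⊆-refl) ⟩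
      r (S ∪ ⁅ e ⁆)          ≤⟨ spanned ⟩
      r S                    ∎

    dependent : Dependent M (S ∪ ⁅ e ⁆)
    dependent = begin-strict
      r (S ∪ ⁅ e ⁆)  ≤⟨ spanned ⟩
      r S            ≤⟨ rk-bounded M S ⟩
      ∣ S ∣          <⟨ n<1+n ∣ S ∣ ⟩
      suc ∣ S ∣      ≡⟨ ∣p∪⁅x⁆∣≡1+∣p∣ S e∉S ⟨
      ∣ S ∪ ⁅ e ⁆ ∣  ∎

    proper-indep : ∀ Y → Y ⊂ S ∪ ⁅ e ⁆ → Independent M Y
    proper-indep Y (Y⊆ , z , z∈ , z∉Y) with z ≟ e
    ... | yes refl = ≤⇒Independent (indep-⊆ S-indep (⊆-∪⁅x⁆-∉ Y⊆ z∉Y))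
    ... | no  z≢e  = ≤⇒Independent (indep-⊆ D-indep (⊆-∪⁅x⁆-∉ Y⊆D∪⁅z⁆ z∉Y))
      where
      z∈S : z ∈ S
      z∈S = ⊆-∪⁅x⁆-∉ {q = ⁅ z ⁆} (λ y∈⁅z⁆ → subst (_∈ S ∪ ⁅ e ⁆) (sym (x∈⁅y⁆⇒x≡y z y∈⁅z⁆)) z∈)
                     (λ e∈⁅z⁆ → z≢e (sym (x∈⁅y⁆⇒x≡y z e∈⁅z⁆))) (x∈⁅x⁆ z)
      D = (S - z) ∪ ⁅ e ⁆
      D-indep : ∣ D ∣ ≤ r D
      D-indep = begin
        ∣ D ∣              ≡⟨ ∣p∪⁅x⁆∣≡1+∣p∣ (S - z) (λ e∈ → e∉S (x∈p-y⇒x∈p S e∈)) ⟩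
        suc ∣ S - z ∣      ≤⟨ s≤s (indep-⊆ S-indep (x∈p-y⇒x∈p S)) ⟩
        suc (r (S - z))    ≤⟨ minimal z∈S ⟩
        r D                ∎
      Y⊆D∪⁅z⁆ : Y ⊆ D ∪ ⁅ z ⁆
      Y⊆D∪⁅z⁆ y∈Y = ∪-least
        (λ y∈S → ∪-least (λ y∈ → p⊆p∪q ⁅ z ⁆ (p⊆p∪q ⁅ e ⁆ y∈)) (q⊆p∪q D ⁅ z ⁆) (p⊆p-x∪⁅x⁆ S z y∈S))
        (λ y∈⁅e⁆ → p⊆p∪q ⁅ z ⁆ (q⊆p∪q (S - z) ⁅ e ⁆ y∈⁅e⁆))
        (Y⊆ y∈Y)

  circuit-through : ∀ S {e} → e ∉ S → r (S ∪ ⁅ e ⁆) ≤ r S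
    → ∃ λ C → IsCircuit M C × e ∈ C × C ⊆ S ∪ ⁅ e ⁆
  circuit-through S {e} = removal-induction CircuitThrough step S
    where
    CircuitThrough : Subset n → Set
    CircuitThrough S = e ∉ S → r (S ∪ ⁅ e ⁆) ≤ r S → ∃ λ C → IsCircuit M C × e ∈ C × C ⊆ S ∪ ⁅ e ⁆

    step : ∀ S → (∀ {x} → x ∈ S → CircuitThrough (S - x)) → CircuitThrough S
    step S ih e∉S spanned with any? (λ x → (x ∈? S) ×-dec (r ((S - x) ∪ ⁅ e ⁆) ≤? r (S - x)))
    ... | yes (x , x∈S , spanned′) =
      let (C , circuit , e∈C , C⊆) = ih x∈S (λ e∈ → e∉S (x∈p-y⇒x∈p S e∈)) spanned′
      in C , circuit , e∈C , (λ y∈C → ∪-mono (x∈p-y⇒x∈p S) ⊆-refl (C⊆ y∈C))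
    ... | no  minimal =
      S ∪ ⁅ e ⁆ ,
      minimal-spanning⇒circuit S e∉S spanned (λ {x} x∈S → ≰⇒> λ le → minimal (x , x∈S , le)) ,
      q⊆p∪q S ⁅ e ⁆ (x∈⁅x⁆ e) ,
      ⊆-refl

  coloop-free⇒cyclic : ∀ Y → (∀ {e} → e ∈ Y → r Y ≤ r (Y - e)) → IsCyclic M Y
  coloop-free⇒cyclic Y coloop-free e e∈Y =
    let (C , circuit , e∈C , C⊆) = circuit-through (Y - e) (λ e∈ → x∈p-y⇒x≢y Y e∈ refl)
                                      (≤-trans (mono Y-e∪⁅e⁆⊆Y) (coloop-free e∈Y))
    in C , circuit , e∈C , (λ x∈C → Y-e∪⁅e⁆⊆Y (C⊆ x∈C))
    where
    Y-e∪⁅e⁆⊆Y : (Y - e) ∪ ⁅ e ⁆ ⊆ Y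
    Y-e∪⁅e⁆⊆Y = ∪-least (x∈p-y⇒x∈p Y) (x∈p⇒⁅x⁆⊆p e∈Y)

  flat-minus-coloop : ∀ {Y e} → IsFlat M Y → e ∈ Y → r (Y - e) < r Y → IsFlat M (Y - e)
  flat-minus-coloop {Y} {e} flat e∈Y coloop f f∉Y-e with f ≟ e
  ... | yes refl = <-≤-trans coloop (mono (p⊆p-x∪⁅x⁆ Y f))
  ... | no  f≢e  = +-cancelˡ-< (r Y) (r (Y - e)) (r ((Y - e) ∪ ⁅ f ⁆)) (begin-strict
    r Y + r (Y - e)            <⟨ +-monoˡ-< (r (Y - e)) (flat f (λ f∈Y → f∉Y-e (x∈p∧x≢y⇒x∈p-y f∈Y f≢e))) ⟩
    r (Y ∪ ⁅ f ⁆) + r (Y - e)  ≤⟨ submod-⊆ (∪-mono ⊆-refl (q⊆p∪q (Y - e) ⁅ f ⁆))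
                                           (∩-greatest (x∈p-y⇒x∈p Y) (p⊆p∪q ⁅ f ⁆)) ⟩
    r Y + r ((Y - e) ∪ ⁅ f ⁆)  ∎)
    where open ≤-Reasoning

  closure : Subset n → Subset n
  closure X = tabulate λ e → does (r (X ∪ ⁅ e ⁆) ≤? r X)

  ∈-closure⁻ : ∀ {X e} → e ∈ closure X → r (X ∪ ⁅ e ⁆) ≤ r X
  ∈-closure⁻ {X} e∈ = dec-true⁻ (_ ≤? r X) (∈-tabulate⁻ _ e∈)

  ∈-closure⁺ : ∀ {X e} → r (X ∪ ⁅ e ⁆) ≤ r X → e ∈ closure X
  ∈-closure⁺ {X} spanned = ∈-tabulate⁺ _ (dec-true (_ ≤? r X) spanned)

  ⊆-closure : ∀ X → X ⊆ closure X
  ⊆-closure X e∈X = ∈-closure⁺ (mono (∪-least ⊆-refl (x∈p⇒⁅x⁆⊆p e∈X)))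

  r-closure : ∀ X → r (closure X) ≤ r X
  r-closure X = ≤-trans (mono (q⊆p∪q X (closure X))) (∪-spanned X (closure X) ∈-closure⁻)

  closure-flat : ∀ X → IsFlat M (closure X)
  closure-flat X f f∉ = begin-strict
    r (closure X)          ≤⟨ r-closure X ⟩
    r X                    <⟨ ≰⇒> (λ spanned → f∉ (∈-closure⁺ spanned)) ⟩
    r (X ∪ ⁅ f ⁆)          ≤⟨ mono (∪-mono (⊆-closure X) ⊆-refl) ⟩
    r (closure X ∪ ⁅ f ⁆)  ∎
    where open ≤-Reasoning

  flat⇒cyclicFlat-below : ∀ Y → IsFlat M Y → ∃ λ F → IsCyclicFlat M F × r F + ∣ Y ─ F ∣ ≤ r Y
  flat⇒cyclicFlat-below = removal-induction Below step
    where
    open ≤-Reasoning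
    Below : Subset n → Set
    Below Y = IsFlat M Y → ∃ λ F → IsCyclicFlat M F × r F + ∣ Y ─ F ∣ ≤ r Y

    step : ∀ Y → (∀ {x} → x ∈ Y → Below (Y - x)) → Below Y
    step Y ih flat with any? (λ e → (e ∈? Y) ×-dec (r (Y - e) <? r Y))
    ... | yes (e , e∈Y , coloop) =
      let (F , cyclicFlat , bound) = ih e∈Y (flat-minus-coloop flat e∈Y coloop)
      in F , cyclicFlat , (begin
        r F + ∣ Y ─ F ∣              ≤⟨ +-monoʳ-≤ (r F) (∣p∣≤1+∣p-x∣ (Y ─ F) e) ⟩
        r F + suc ∣ Y ─ F ─ ⁅ e ⁆ ∣  ≡⟨ cong (λ Z → r F + suc ∣ Z ∣) (p─q─r≡p─r─q Y F ⁅ e ⁆) ⟩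
        r F + suc ∣ (Y - e) ─ F ∣    ≡⟨ +-suc (r F) _ ⟩
        suc (r F + ∣ (Y - e) ─ F ∣)  ≤⟨ s≤s bound ⟩
        suc (r (Y - e))              ≤⟨ coloop ⟩
        r Y                          ∎)
    ... | no  coloop-free =
      Y , (flat , coloop-free⇒cyclic Y (λ {e} e∈Y → ≮⇒≥ λ lt → coloop-free (e , e∈Y , lt))) ,
      ≤-reflexive (trans (cong (r Y +_) (∣p─p∣≡0 Y)) (+-identityʳ (r Y)))

  cyclicFlat-bound : ∀ X → ∃ λ F → IsCyclicFlat M F × r F + ∣ X ─ F ∣ ≤ r X
  cyclicFlat-bound X =
    let (F , cyclicFlat , bound) = flat⇒cyclicFlat-below (closure X) (closure-flat X)
    in F , cyclicFlat , (begin
      r F + ∣ X ─ F ∣          ≤⟨ +-monoʳ-≤ (r F) (p⊆q⇒∣p∣≤∣q∣ (X─F⊆ {F})) ⟩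
      r F + ∣ closure X ─ F ∣  ≤⟨ bound ⟩
      r (closure X)            ≤⟨ r-closure X ⟩
      r X                      ∎)
    where
    open ≤-Reasoning
    X─F⊆ : ∀ {F} → X ─ F ⊆ closure X ─ F
    X─F⊆ {F} x∈ = x∈p∧x∉q⇒x∈p─q (⊆-closure X (p─q⊆p X F x∈)) (x∈p─q⇒x∉q X F x∈)

module Coordinates (m n : ℕ) where

  ∈-rowSet⁻ : ∀ {e : Fin m} (X : Subset n) {z}
    → z ∈ rowSet e X → quotient {m} n z ≡ e × remainder {m} n z ∈ X
  ∈-rowSet⁻ {e} X {z} z∈ =
    dec-true⁻ (_ ≟ e) (Boolₚ.∧-conicalˡ _ _ z∈′) , lookup⇒[]= _ X (Boolₚ.∧-conicalʳ _ _ z∈′)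
    where z∈′ = ∈-tabulate⁻ _ z∈

  ∈-rowSet⁺ : ∀ {e : Fin m} {X : Subset n} {z}
    → quotient {m} n z ≡ e → remainder {m} n z ∈ X → z ∈ rowSet e X
  ∈-rowSet⁺ {e} q≡e rem∈X = ∈-tabulate⁺ _ (cong₂ _∧_ (dec-true (_ ≟ e) q≡e) ([]=⇒lookup rem∈X))

  ∈-colSet⁻ : ∀ {f : Fin n} (Y : Subset m) {z}
    → z ∈ colSet f Y → remainder {m} n z ≡ f × quotient {m} n z ∈ Y
  ∈-colSet⁻ {f} Y {z} z∈ =
    dec-true⁻ (_ ≟ f) (Boolₚ.∧-conicalˡ _ _ z∈′) , lookup⇒[]= _ Y (Boolₚ.∧-conicalʳ _ _ z∈′)
    where z∈′ = ∈-tabulate⁻ _ z∈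

  ∈-colSet⁺ : ∀ {f : Fin n} {Y : Subset m} {z}
    → remainder {m} n z ≡ f → quotient {m} n z ∈ Y → z ∈ colSet f Y
  ∈-colSet⁺ {f} r≡f quot∈Y = ∈-tabulate⁺ _ (cong₂ _∧_ (dec-true (_ ≟ f) r≡f) ([]=⇒lookup quot∈Y))

  rowSet-mono : ∀ {e : Fin m} {X Y : Subset n} → X ⊆ Y → rowSet e X ⊆ rowSet e Y
  rowSet-mono {X = X} X⊆Y z∈ = let (q≡e , rem∈X) = ∈-rowSet⁻ X z∈ in ∈-rowSet⁺ q≡e (X⊆Y rem∈X)

  rowSet-∪ : ∀ {e : Fin m} (X Y : Subset n) → rowSet e (X ∪ Y) ⊆ rowSet e X ∪ rowSet e Y
  rowSet-∪ X Y z∈ with ∈-rowSet⁻ (X ∪ Y) z∈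
  ... | q≡e , rem∈ with x∈p∪q⁻ X Y rem∈
  ...   | inj₁ rem∈X = p⊆p∪q _ (∈-rowSet⁺ q≡e rem∈X)
  ...   | inj₂ rem∈Y = q⊆p∪q _ _ (∈-rowSet⁺ q≡e rem∈Y)

module Blocks (k : ℕ) where

  ∈-block⁻ : ∀ i {x : Fin (4 * k)} → x ∈ block k i → quotient {4} k x ≡ i
  ∈-block⁻ i x∈ = dec-true⁻ (_ ≟ i) (∈-tabulate⁻ _ x∈)

  combine∈block : ∀ i (x : Fin k) → combine i x ∈ block k i
  combine∈block i x = ∈-tabulate⁺ _ (dec-true (_ ≟ i) (cong proj₁ (remQuot-combine i x)))

  block-disjoint : ∀ {x : Fin (4 * k)} i i′ → i ≢ i′ → x ∈ block k i → x ∉ block k i′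
  block-disjoint i i′ i≢i′ x∈ x∈′ = i≢i′ (trans (sym (∈-block⁻ i x∈)) (∈-block⁻ i′ x∈′))

  ∉two-blocks : ∀ {x : Fin (4 * k)} i i₁ i₂ → i ≢ i₁ → i ≢ i₂ → x ∈ block k i → x ∉ block k i₁ ∪ block k i₂
  ∉two-blocks i i₁ i₂ i≢i₁ i≢i₂ x∈ x∈∪ =
    [ block-disjoint i i₁ i≢i₁ x∈ , block-disjoint i i₂ i≢i₂ x∈ ] (x∈p∪q⁻ (block k i₁) (block k i₂) x∈∪)

  k≤∣block∣ : ∀ i → k ≤ ∣ block k i ∣
  k≤∣block∣ i = injection⇒≤∣p∣ (combine i) (λ {x} {y} → combine-injectiveʳ i x i y) (combine∈block i)

U23-loopless : ∀ i → ¬ IsLoop U23 i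
U23-loopless zero             ()
U23-loopless (suc zero)       ()
U23-loopless (suc (suc zero)) ()

U23-spanned-by-two : ∀ i → rk U23 ⊤ ≡ rk U23 (⊤ - i)
U23-spanned-by-two zero             = refl
U23-spanned-by-two (suc zero)       = refl
U23-spanned-by-two (suc (suc zero)) = refl

Ingleton : ∀ {n} → Matroid n → Set
Ingleton M = ∀ A B C D →
  r A + r B + r (A ∪ B ∪ C) + r (A ∪ B ∪ D) + r (C ∪ D)
    ≤ r (A ∪ B) + r (A ∪ C) + r (A ∪ D) + r (B ∪ C) + r (B ∪ D)
  where r = rk M

module QuasiProductWithU23 {n} (N : Matroid n) (P : Matroid (3 * n))
                           (quasi : IsQuasiProduct U23 N P) where

  module N = Rank N
  module P = Rank P
  open Coordinates 3 n

  row : Fin 3 → Subset n → Subset (3 * n)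
  row = rowSet

  R : Fin 3 → Subset (3 * n)
  R i = row i ⊤

  col : Fin n → Subset 3 → Subset (3 * n)
  col = colSet

  r-row : ∀ i X → P.r (row i X) ≡ N.r X
  r-row i X = sym (proj₁ quasi i (U23-loopless i) X)

  -- each column is a copy of U₂,₃ or consists of loops, so any two of its entries span it
  r-col-spanned : ∀ x i → P.r (col x ⊤) ≤ P.r (col x (⊤ - i))
  r-col-spanned x i with N.r ⁅ x ⁆ ≟ℕ 0
  ... | yes loop    = ≤-trans (≤-reflexive (proj₂ (proj₂ (proj₂ quasi)) x loop)) z≤n
  ... | no  nonloop = ≤-reflexive (begin-equality
    P.r (col x ⊤)        ≡⟨ col≅U23 ⊤ ⟨
    rk U23 ⊤             ≡⟨ U23-spanned-by-two i ⟩
    rk U23 (⊤ - i)       ≡⟨ col≅U23 (⊤ - i) ⟩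
    P.r (col x (⊤ - i))  ∎)
    where
    open ≤-Reasoning
    col≅U23 : ∀ Y → rk U23 Y ≡ P.r (col x Y)
    col≅U23 = proj₁ (proj₂ quasi) x nonloop

  row-spanned : ∀ {T X U} i → (∀ q → q ≢ i → row q X ⊆ T) → U ⊆ T ∪ row i X → P.r U ≤ P.r T
  row-spanned {T} {X} i other-rows U⊆ =
    ≤-trans (P.mono U⊆) (P.∪-spanned T (row i X) element-spanned)
    where
    element-spanned : ∀ {e} → e ∈ row i X → P.r (T ∪ ⁅ e ⁆) ≤ P.r T
    element-spanned {e} e∈ = P.spanned-⊆ col⊆T ⊆⊤-col (r-col-spanned x i)
                                          (∪-mono ⊆-refl (x∈p⇒⁅x⁆⊆p e∈col))
      where
      x = remainder {3} n e
      ⊆⊤-col : col x (⊤ - i) ⊆ col x ⊤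
      ⊆⊤-col z∈ = ∈-colSet⁺ (proj₁ (∈-colSet⁻ (⊤ - i) z∈)) ∈⊤
      e∈col : e ∈ col x ⊤
      e∈col = ∈-colSet⁺ refl ∈⊤
      col⊆T : col x (⊤ - i) ⊆ T
      col⊆T {z} z∈ =
        let (rem≡x , q∈) = ∈-colSet⁻ (⊤ - i) z∈ in
        other-rows _ (x∈p-y⇒x≢y ⊤ q∈)
          (∈-rowSet⁺ refl (subst (_∈ X) (sym rem≡x) (proj₂ (∈-rowSet⁻ X e∈))))

  r⊤-spanned-by-rows : ∀ {T} i → (∀ q → q ≢ i → R q ⊆ T) → P.r ⊤ ≤ P.r T
  r⊤-spanned-by-rows {T} i other-rows = row-spanned {X = ⊤} i other-rows ⊤⊆
    where
    ⊤⊆ : ⊤ ⊆ T ∪ R i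
    ⊤⊆ {z} _ with quotient {3} n z ≟ i
    ... | yes q≡i = q⊆p∪q T (R i) (∈-rowSet⁺ q≡i ∈⊤)
    ... | no  q≢i = p⊆p∪q (R i) (other-rows _ q≢i (∈-rowSet⁺ refl ∈⊤))

  rows-skew : ∀ {i i′} → N.r ⊤ + N.r ⊤ ≤ P.r (R i ∪ R i′)
    → ∀ X Y → N.r X + N.r Y ≤ P.r (row i X ∪ row i′ Y)
  rows-skew {i} {i′} two-rows X Y = +-cancelˡ-≤ (ρ + ρ) _ _ (begin
    ρ + ρ + (N.r X + N.r Y)                                 ≤⟨ +-monoˡ-≤ _ two-rows ⟩
    P.r (R i ∪ R i′) + (N.r X + N.r Y)                      ≡⟨ cong₂ (λ a b → P.r (R i ∪ R i′) + (a + b))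
                                                                      (r-row i X) (r-row i′ Y) ⟨
    P.r (R i ∪ R i′) + (P.r (row i X) + P.r (row i′ Y))     ≤⟨ P.skew-⊆ (rowSet-mono {X = X} ⊆⊤) (rowSet-mono {X = Y} ⊆⊤) ⟩
    P.r (row i X ∪ row i′ Y) + (P.r (R i) + P.r (R i′))     ≡⟨ cong₂ (λ a b → P.r (row i X ∪ row i′ Y) + (a + b))
                                                                      (r-row i ⊤) (r-row i′ ⊤) ⟩
    P.r (row i X ∪ row i′ Y) + (ρ + ρ)                      ≡⟨ +-comm _ (ρ + ρ) ⟩
    ρ + ρ + P.r (row i X ∪ row i′ Y)                        ∎)
    where
    open ≤-Reasoning
    ρ = N.r ⊤

  rows-subadditive : ∀ i i′ X Y → P.r (row i X ∪ row i′ Y) ≤ N.r X + N.r Y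
  rows-subadditive i i′ X Y =
    subst₂ (λ a b → P.r (row i X ∪ row i′ Y) ≤ a + b) (r-row i X) (r-row i′ Y) (P.subadditive ⊆-refl)

  i₀ i₁ i₂ : Fin 3
  i₀ = zero
  i₁ = suc zero
  i₂ = suc (suc zero)

  module FullRank (full : N.r ⊤ + N.r ⊤ ≤ P.r ⊤) where

    skew₀₁ : ∀ X Y → N.r X + N.r Y ≤ P.r (row i₀ X ∪ row i₁ Y)
    skew₀₁ = rows-skew (≤-trans full (r⊤-spanned-by-rows i₂ other-rows))
      where
      other-rows : ∀ q → q ≢ i₂ → R q ⊆ R i₀ ∪ R i₁
      other-rows zero             _    = p⊆p∪q (R i₁)
      other-rows (suc zero)       _    = q⊆p∪q (R i₀) (R i₁)
      other-rows (suc (suc zero)) q≢i₂ = contradiction refl q≢i₂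

    skew₀₂ : ∀ X Y → N.r X + N.r Y ≤ P.r (row i₀ X ∪ row i₂ Y)
    skew₀₂ = rows-skew (≤-trans full (r⊤-spanned-by-rows i₁ other-rows))
      where
      other-rows : ∀ q → q ≢ i₁ → R q ⊆ R i₀ ∪ R i₂
      other-rows zero             _    = p⊆p∪q (R i₂)
      other-rows (suc zero)       q≢i₁ = contradiction refl q≢i₁
      other-rows (suc (suc zero)) _    = q⊆p∪q (R i₀) (R i₂)

    three-rows : ∀ {X W V Z} → X ⊆ W → X ⊆ V → X ⊆ Z
      → P.r (row i₀ W ∪ row i₁ V ∪ row i₂ Z) + (N.r X + N.r X) ≤ (N.r W + N.r V) + (N.r X + N.r Z)
    three-rows {X} {W} {V} {Z} X⊆W X⊆V X⊆Z = begin
      P.r U + (N.r X + N.r X)                   ≤⟨ +-monoʳ-≤ (P.r U) (skew₀₁ X X) ⟩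
      P.r U + P.r (row i₀ X ∪ row i₁ X)         ≤⟨ P.submod-⊆ U⊆ I⊆ ⟩
      P.r S + P.r (row i₀ X ∪ T)                ≤⟨ +-monoʳ-≤ (P.r S) (row-spanned {X = X} i₀ other-rows T₀⊆) ⟩
      P.r S + P.r T                             ≤⟨ +-mono-≤ (rows-subadditive i₀ i₁ W V) (rows-subadditive i₁ i₂ X Z) ⟩
      (N.r W + N.r V) + (N.r X + N.r Z)         ∎
      where
      open ≤-Reasoning
      U = row i₀ W ∪ row i₁ V ∪ row i₂ Z
      S = row i₀ W ∪ row i₁ V
      T = row i₁ X ∪ row i₂ Z
      U⊆ : U ⊆ S ∪ (row i₀ X ∪ T)
      U⊆ = ∪-least (λ x∈ → p⊆p∪q _ (p⊆p∪q _ x∈))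
             (∪-least (λ x∈ → p⊆p∪q _ (q⊆p∪q _ _ x∈)) (λ x∈ → q⊆p∪q S _ (q⊆p∪q _ T (q⊆p∪q _ _ x∈))))
      I⊆ : row i₀ X ∪ row i₁ X ⊆ S ∩ (row i₀ X ∪ T)
      I⊆ = ∩-greatest (∪-mono (rowSet-mono X⊆W) (rowSet-mono X⊆V)) (∪-mono ⊆-refl (p⊆p∪q _))
      other-rows : ∀ q → q ≢ i₀ → row q X ⊆ T
      other-rows zero             q≢i₀ = contradiction refl q≢i₀
      other-rows (suc zero)       _    = p⊆p∪q _
      other-rows (suc (suc zero)) _    = λ x∈ → q⊆p∪q _ _ (rowSet-mono X⊆Z x∈)
      T₀⊆ : row i₀ X ∪ T ⊆ T ∪ row i₀ X
      T₀⊆ = ∪-least (q⊆p∪q T _) (p⊆p∪q _)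

    module Contraction (A B : Subset n) where

      K : Subset (3 * n)
      K = row i₀ A ∪ row i₁ B

      -- φ Z - rk K is the rank of row₂ Z in the contraction P / K
      φ : Subset n → ℕ
      φ Z = P.r (K ∪ row i₂ Z)

      φ-submod : ∀ {X Y U I} → U ⊆ X ∪ Y → I ⊆ X ∩ Y → φ U + φ I ≤ φ X + φ Y
      φ-submod {X} {Y} {U} {I} U⊆ I⊆ = P.submod-⊆
        (∪-least (λ z∈ → p⊆p∪q KY (p⊆p∪q (row i₂ X) z∈)) (λ z∈ → ∪-mono (q⊆p∪q K (row i₂ X)) (q⊆p∪q K (row i₂ Y))
                                            (rowSet-∪ X Y (rowSet-mono {X = U} U⊆ z∈))))
        (∩-greatest (∪-mono ⊆-refl (rowSet-mono {X = I} (λ x∈ → proj₁ (x∈p∩q⁻ X Y (I⊆ x∈)))))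
                    (∪-mono ⊆-refl (rowSet-mono {X = I} (λ x∈ → proj₂ (x∈p∩q⁻ X Y (I⊆ x∈))))))
        where KY = K ∪ row i₂ Y

      φ⊤-lower : N.r (A ∪ B) + N.r ⊤ ≤ φ ⊤
      φ⊤-lower = ≤-trans (skew₀₂ (A ∪ B) ⊤) (row-spanned {X = B} i₀ other-rows ⊆K∪R₂∪row₀B)
        where
        other-rows : ∀ q → q ≢ i₀ → row q B ⊆ K ∪ R i₂
        other-rows zero             q≢i₀ = contradiction refl q≢i₀
        other-rows (suc zero)       _    = λ z∈ → p⊆p∪q (R i₂) (q⊆p∪q (row i₀ A) (row i₁ B) z∈)
        other-rows (suc (suc zero)) _    = λ z∈ → q⊆p∪q K (R i₂) (rowSet-mono {X = B} ⊆⊤ z∈)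
        ⊆K∪R₂∪row₀B : row i₀ (A ∪ B) ∪ R i₂ ⊆ (K ∪ R i₂) ∪ row i₀ B
        ⊆K∪R₂∪row₀B = ∪-least
          (λ z∈ → [ (λ z∈A → p⊆p∪q (row i₀ B) (p⊆p∪q (R i₂) (p⊆p∪q (row i₁ B) z∈A))) ,
                    q⊆p∪q (K ∪ R i₂) (row i₀ B) ]
                    (x∈p∪q⁻ (row i₀ A) (row i₀ B) (rowSet-∪ A B z∈)))
          (λ z∈ → p⊆p∪q (row i₀ B) (q⊆p∪q K (R i₂) z∈))

      φ-lower : ∀ Z → N.r (A ∪ B) + N.r Z ≤ φ Z
      φ-lower Z = +-cancelʳ-≤ ρ _ _ (begin
        N.r (A ∪ B) + N.r Z + ρ           ≡⟨ +-assoc (N.r (A ∪ B)) (N.r Z) ρ ⟩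
        N.r (A ∪ B) + (N.r Z + ρ)         ≡⟨ cong (N.r (A ∪ B) +_) (+-comm (N.r Z) ρ) ⟩
        N.r (A ∪ B) + (ρ + N.r Z)         ≡⟨ +-assoc (N.r (A ∪ B)) ρ (N.r Z) ⟨
        N.r (A ∪ B) + ρ + N.r Z           ≤⟨ +-monoˡ-≤ (N.r Z) φ⊤-lower ⟩
        φ ⊤ + N.r Z                       ≡⟨ cong (φ ⊤ +_) (r-row i₂ Z) ⟨
        φ ⊤ + P.r (row i₂ Z)              ≤⟨ P.submod-⊆ (∪-mono (p⊆p∪q (row i₂ Z)) ⊆-refl)
                                                        (∩-greatest (q⊆p∪q K (row i₂ Z)) (rowSet-mono {X = Z} ⊆⊤)) ⟩
        φ Z + P.r (R i₂)                  ≡⟨ cong (φ Z +_) (r-row i₂ ⊤) ⟩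
        φ Z + ρ                           ∎)
        where
        open ≤-Reasoning
        ρ = N.r ⊤

      φ-upper : ∀ {X W V Z} → A ⊆ W → B ⊆ V → X ⊆ W → X ⊆ V → X ⊆ Z
        → φ Z + (N.r X + N.r X) ≤ (N.r W + N.r V) + (N.r X + N.r Z)
      φ-upper {X} {W} {V} {Z} A⊆W B⊆V X⊆W X⊆V X⊆Z =
        ≤-trans (+-monoˡ-≤ (N.r X + N.r X) (P.mono K∪row₂Z⊆)) (three-rows X⊆W X⊆V X⊆Z)
        where
        K∪row₂Z⊆ : K ∪ row i₂ Z ⊆ row i₀ W ∪ row i₁ V ∪ row i₂ Z
        K∪row₂Z⊆ = ∪-least
          (∪-mono (rowSet-mono A⊆W) (λ z∈ → p⊆p∪q (row i₂ Z) (rowSet-mono B⊆V z∈)))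
          (λ z∈ → q⊆p∪q (row i₀ W) _ (q⊆p∪q (row i₁ V) (row i₂ Z) z∈))

      φ-triangle : ∀ Z → N.r (A ∪ B ∪ Z) + φ Z ≤ N.r (A ∪ B) + N.r (A ∪ Z) + N.r (B ∪ Z)
      φ-triangle Z = +-cancelˡ-≤ ab _ _ (begin
        ab + (N.r (A ∪ B ∪ Z) + φ Z)      ≡⟨ +-assoc ab _ (φ Z) ⟨
        ab + N.r (A ∪ B ∪ Z) + φ Z        ≤⟨ +-monoˡ-≤ (φ Z) (φ-lower (A ∪ B ∪ Z)) ⟩
        φ (A ∪ B ∪ Z) + φ Z               ≤⟨ φ-submod ABZ⊆ (∩-greatest (q⊆p∪q A Z) (q⊆p∪q B Z)) ⟩
        φ (A ∪ Z) + φ (B ∪ Z)             ≤⟨ +-mono-≤ φ-AZ φ-BZ ⟩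
        (ab + az) + (ab + bz)             ≡⟨ regroup ab az bz ⟩
        ab + (ab + az + bz)               ∎)
        where
        open ≤-Reasoning
        ab = N.r (A ∪ B)
        az = N.r (A ∪ Z)
        bz = N.r (B ∪ Z)
        ABZ⊆ : A ∪ B ∪ Z ⊆ (A ∪ Z) ∪ (B ∪ Z)
        ABZ⊆ = ∪-least (λ x∈ → p⊆p∪q (B ∪ Z) (p⊆p∪q Z x∈))
                 (∪-least (λ x∈ → q⊆p∪q (A ∪ Z) (B ∪ Z) (p⊆p∪q Z x∈))
                          (λ x∈ → p⊆p∪q (B ∪ Z) (q⊆p∪q A Z x∈)))
        regroup : ∀ x y z → (x + y) + (x + z) ≡ x + (x + y + z)
        regroup = solve-∀
        diagonal : ∀ x y z → (x + y) + (x + z) ≡ (y + z) + (x + x)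
        diagonal = solve-∀
        cancel-diagonal : ∀ {t x y z} → t + (x + x) ≤ (x + y) + (x + z) → t ≤ y + z
        cancel-diagonal {t} {x} {y} {z} le =
          +-cancelʳ-≤ (x + x) t (y + z) (≤-trans le (≤-reflexive (diagonal x y z)))
        φ-AZ : φ (A ∪ Z) ≤ ab + az
        φ-AZ = cancel-diagonal {x = N.r A} {ab} {az} (φ-upper ⊆-refl (q⊆p∪q A B) ⊆-refl (p⊆p∪q B) (p⊆p∪q Z))
        φ-BZ : φ (B ∪ Z) ≤ ab + bz
        φ-BZ = cancel-diagonal {x = N.r B} {ab} {bz} (subst (λ t → φ (B ∪ Z) + (N.r B + N.r B) ≤ t + (N.r B + bz)) (+-comm ab (N.r B))
                 (φ-upper (p⊆p∪q B) ⊆-refl (q⊆p∪q A B) ⊆-refl (p⊆p∪q Z)))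

    ingleton : Ingleton N
    ingleton A B C D = +-cancelˡ-≤ ab _ _ (begin
      ab + (a + b + abc + abd + cd)     ≡⟨ regroup₁ ab cd a b abc abd ⟩
      ab + cd + (a + b) + (abc + abd)   ≤⟨ +-monoˡ-≤ (abc + abd) (+-mono-≤ (φ-lower (C ∪ D)) ab-skew) ⟩
      φ (C ∪ D) + φ ⊥ + (abc + abd)     ≤⟨ +-monoˡ-≤ (abc + abd) (φ-submod {C} {D} ⊆-refl ⊥⊆) ⟩
      φ C + φ D + (abc + abd)           ≡⟨ regroup₂ (φ C) (φ D) abc abd ⟩
      (abc + φ C) + (abd + φ D)         ≤⟨ +-mono-≤ (φ-triangle C) (φ-triangle D) ⟩
      (ab + ac + bc) + (ab + ad + bd)   ≡⟨ regroup₃ ab ac ad bc bd ⟩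
      ab + (ab + ac + ad + bc + bd)     ∎)
      where
      open Contraction A B
      open ≤-Reasoning
      a = N.r A
      b = N.r B
      ab = N.r (A ∪ B)
      ac = N.r (A ∪ C)
      ad = N.r (A ∪ D)
      bc = N.r (B ∪ C)
      bd = N.r (B ∪ D)
      cd = N.r (C ∪ D)
      abc = N.r (A ∪ B ∪ C)
      abd = N.r (A ∪ B ∪ D)
      ab-skew : a + b ≤ φ ⊥
      ab-skew = ≤-trans (skew₀₁ A B) (P.mono (p⊆p∪q (row i₂ ⊥)))
      regroup₁ : ∀ ab cd a b abc abd → ab + (a + b + abc + abd + cd) ≡ ab + cd + (a + b) + (abc + abd)
      regroup₁ = solve-∀
      regroup₂ : ∀ c d abc abd → c + d + (abc + abd) ≡ (abc + c) + (abd + d)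
      regroup₂ = solve-∀
      regroup₃ : ∀ ab ac ad bc bd → (ab + ac + bc) + (ab + ad + bd) ≡ ab + (ab + ac + ad + bc + bd)
      regroup₃ = solve-∀

quasiProduct-ingleton : ∀ {n} {N : Matroid n} {P : Matroid (3 * n)}
  → IsQuasiProduct U23 N P → rank N + rank N ≤ rank P → Ingleton N
quasiProduct-ingleton {N = N} {P} quasi = QuasiProductWithU23.FullRank.ingleton N P quasi

quasiProduct-rank< : ∀ {n} {N : Matroid n} {P : Matroid (3 * n)}
  → ¬ Ingleton N → IsQuasiProduct U23 N P → rank P < rank N + rank N
quasiProduct-rank< {N = N} {P} ¬ingleton quasi =
  ≰⇒> λ full → ¬ingleton (quasiProduct-ingleton {N = N} {P} quasi full)

module Mr (j : ℕ) (N : Matroid (4 * (2 + j))) (isMr : IsMr (4 + j) N) where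

  open Rank N
  open Blocks (2 + j)
  open ≤-Reasoning

  k : ℕ
  k = 2 + j

  i₂ i₃ : Fin 4
  i₂ = suc (suc zero)
  i₃ = suc (suc (suc zero))

  A B C D : Subset (4 * k)
  A = blockA k
  B = blockB k
  C = blockC k
  D = blockD k

  r-distinguished : ∀ {F} → IsDistinguished k F → r F ≡ suc k
  r-distinguished = proj₂ (proj₂ (proj₂ isMr)) _

  -- the three hypotheses bound rk F + ∣ X ─ F ∣ for the cyclic flats F = ∅, F = E
  -- and F distinguished
  r-lower-bound : ∀ X t → t ≤ ∣ X ∣ → t ≤ 2 + k
    → (∀ F → IsDistinguished k F → t ≤ suc k + ∣ X ─ F ∣) → t ≤ r X
  r-lower-bound X t t≤∣X∣ t≤rank t≤distinguished with cyclicFlat-bound X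
  ... | F , cyclicFlat , bound with nonempty? F | ≡-dec Boolₚ._≟_ F ⊤
  ...   | no F-empty | _ = begin
    t                ≤⟨ t≤∣X∣ ⟩
    ∣ X ∣            ≤⟨ p⊆q⇒∣p∣≤∣q∣ {p = X} {q = X ─ F} (λ x∈X → x∈p∧x∉q⇒x∈p─q x∈X λ x∈F → F-empty (_ , x∈F)) ⟩
    ∣ X ─ F ∣        ≤⟨ m≤n+m ∣ X ─ F ∣ (r F) ⟩
    r F + ∣ X ─ F ∣  ≤⟨ bound ⟩
    r X              ∎
  ...   | yes _ | yes refl = begin
    t                ≤⟨ t≤rank ⟩
    2 + k            ≡⟨ proj₁ isMr ⟨
    r ⊤              ≤⟨ m≤m+n (r ⊤) ∣ X ─ ⊤ ∣ ⟩
    r ⊤ + ∣ X ─ ⊤ ∣  ≤⟨ bound ⟩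
    r X              ∎
  ...   | yes F-nonempty | no F≢⊤ = begin
    t                ≤⟨ t≤distinguished F distinguished ⟩
    suc k + ∣ X ─ F ∣ ≡⟨ cong (_+ ∣ X ─ F ∣) (r-distinguished distinguished) ⟨
    r F + ∣ X ─ F ∣  ≤⟨ bound ⟩
    r X              ∎
    where
    distinguished : IsDistinguished k F
    distinguished = proj₁ (proj₂ isMr) F (F-nonempty , F≢⊤ , cyclicFlat)

  r-block : ∀ i → k ≤ r (block k i)
  r-block i = r-lower-bound (block k i) k (k≤∣block∣ i) (m≤n+m k 2)
                (λ _ _ → ≤-trans (n≤1+n k) (m≤m+n (suc k) _))

  c d : Fin (4 * k)
  c = combine i₂ (zero {suc j})
  d = combine i₃ (zero {suc j})

  c∈C : c ∈ C
  c∈C = combine∈block i₂ zero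

  d∈D : d ∈ D
  d∈D = combine∈block i₃ zero

  C∪D⊈distinguished : ∀ {F} → IsDistinguished k F → ∃ λ x → x ∈ C ∪ D × x ∉ F
  C∪D⊈distinguished (inj₁ refl) =
    c , p⊆p∪q D c∈C , ∉two-blocks i₂ _ _ (λ ()) (λ ()) c∈C
  C∪D⊈distinguished (inj₂ (inj₁ refl)) =
    d , q⊆p∪q C D d∈D , ∉two-blocks i₃ _ _ (λ ()) (λ ()) d∈D
  C∪D⊈distinguished (inj₂ (inj₂ (inj₁ refl))) =
    c , p⊆p∪q D c∈C , ∉two-blocks i₂ _ _ (λ ()) (λ ()) c∈C
  C∪D⊈distinguished (inj₂ (inj₂ (inj₂ (inj₁ refl)))) =
    d , q⊆p∪q C D d∈D , ∉two-blocks i₃ _ _ (λ ()) (λ ()) d∈D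
  C∪D⊈distinguished (inj₂ (inj₂ (inj₂ (inj₂ refl)))) =
    c , p⊆p∪q D c∈C , ∉two-blocks i₂ _ _ (λ ()) (λ ()) c∈C

  r-C∪D : 2 + k ≤ r (C ∪ D)
  r-C∪D = r-lower-bound (C ∪ D) (2 + k) 2+k≤∣C∪D∣ ≤-refl λ F distinguished →
    let (x , x∈C∪D , x∉F) = C∪D⊈distinguished distinguished in begin
      2 + k                   ≡⟨ +-comm 1 (suc k) ⟩
      suc k + 1               ≤⟨ +-monoʳ-≤ (suc k) (≤-<-trans z≤n (x∈p⇒∣p-x∣<∣p∣ (x∈p∧x∉q⇒x∈p─q x∈C∪D x∉F))) ⟩
      suc k + ∣ C ∪ D ─ F ∣   ∎
    where
    C∩D≡∅ : ∣ C ∩ D ∣ ≡ 0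
    C∩D≡∅ = ∣Empty∣≡0 λ (x , x∈) →
      let (x∈C , x∈D) = x∈p∩q⁻ C D x∈ in block-disjoint i₂ i₃ (λ ()) x∈C x∈D
    2+k≤∣C∪D∣ : 2 + k ≤ ∣ C ∪ D ∣
    2+k≤∣C∪D∣ = begin
      2 + k                    ≤⟨ +-monoˡ-≤ k (m≤m+n 2 j) ⟩
      k + k                    ≤⟨ +-mono-≤ (k≤∣block∣ i₂) (k≤∣block∣ i₃) ⟩
      ∣ C ∣ + ∣ D ∣            ≡⟨ ∣p∪q∣+∣p∩q∣≡∣p∣+∣q∣ C D ⟨
      ∣ C ∪ D ∣ + ∣ C ∩ D ∣    ≡⟨ trans (cong (∣ C ∪ D ∣ +_) C∩D≡∅) (+-identityʳ _) ⟩
      ∣ C ∪ D ∣                ∎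

  r-A∪B∪ : ∀ i → i ≢ zero → i ≢ suc zero → 2 + k ≤ r (A ∪ B ∪ block k i)
  r-A∪B∪ i i≢0 i≢1 = begin
    2 + k                   ≡⟨ cong suc (r-distinguished (inj₁ refl)) ⟨
    suc (r (A ∪ B))         ≤⟨ A∪B-flat e (∉two-blocks i zero (suc zero) i≢0 i≢1 e∈) ⟩
    r ((A ∪ B) ∪ ⁅ e ⁆)     ≤⟨ mono (∪-least (∪-mono {p = A} {q = B} ⊆-refl (p⊆p∪q (block k i)))
                                              (x∈p⇒⁅x⁆⊆p (q⊆p∪q A (B ∪ block k i) (q⊆p∪q B (block k i) e∈)))) ⟩
    r (A ∪ B ∪ block k i)   ∎
    where
    e = combine i (zero {suc j})
    e∈ = combine∈block i zero
    A∪B-flat : IsFlat N (A ∪ B)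
    A∪B-flat = proj₁ (proj₂ (proj₂ (proj₁ (proj₂ (proj₂ isMr)) (A ∪ B) (inj₁ refl))))

  ¬ingleton : ¬ Ingleton N
  ¬ingleton ingleton = 1+n≰n (begin
    suc (s + s + s + s + s)                                      ≡⟨ count k ⟩
    k + k + (2 + k) + (2 + k) + (2 + k)                          ≤⟨ lower ⟩
    r A + r B + r (A ∪ B ∪ C) + r (A ∪ B ∪ D) + r (C ∪ D)        ≤⟨ ingleton A B C D ⟩
    r (A ∪ B) + r (A ∪ C) + r (A ∪ D) + r (B ∪ C) + r (B ∪ D)    ≡⟨ upper ⟩
    s + s + s + s + s                                            ∎)
    where
    s = suc k
    count : ∀ k → 1 + ((1 + k) + (1 + k) + (1 + k) + (1 + k) + (1 + k)) ≡ k + k + (2 + k) + (2 + k) + (2 + k)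
    count = solve-∀
    lower = +-mono-≤ (+-mono-≤ (+-mono-≤ (+-mono-≤ (r-block zero) (r-block (suc zero)))
              (r-A∪B∪ i₂ (λ ()) (λ ()))) (r-A∪B∪ i₃ (λ ()) (λ ()))) r-C∪D
    upper = cong₂ _+_ (cong₂ _+_ (cong₂ _+_ (cong₂ _+_
              (r-distinguished (inj₁ refl))
              (r-distinguished (inj₂ (inj₁ refl))))
              (r-distinguished (inj₂ (inj₂ (inj₁ refl)))))
              (r-distinguished (inj₂ (inj₂ (inj₂ (inj₁ refl))))))
              (r-distinguished (inj₂ (inj₂ (inj₂ (inj₂ refl)))))

mainTheorem9 : (r : ℕ) → 4 ≤ r → (N : Matroid (4 * (r ∸ 2))) → IsMr r N
    → ((P : Matroid (3 * (4 * (r ∸ 2)))) → IsQuasiProduct U23 N P → rank P ≤ 2 * r ∸ 1)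
      × ((P : Matroid (3 * (4 * (r ∸ 2)))) → ¬ IsTensorProduct U23 N P)
mainTheorem9 r@(suc (suc (suc (suc j)))) (s≤s (s≤s (s≤s (s≤s z≤n)))) N isMr = rank-bound , no-tensor
  where
  ¬ingleton : ¬ Ingleton N
  ¬ingleton = Mr.¬ingleton j N isMr

  -- r is a successor, so 2 * r ∸ 1 is definitionally the predecessor of 2 * r
  rank-bound : ∀ P → IsQuasiProduct U23 N P → rank P ≤ 2 * r ∸ 1
  rank-bound P quasi = ≤-pred (subst (rank P <_) ρ+ρ≡2r (quasiProduct-rank< {N = N} {P} ¬ingleton quasi))
    where
    ρ+ρ≡2r : rank N + rank N ≡ 2 * r
    ρ+ρ≡2r = trans (cong₂ _+_ (proj₁ isMr) (proj₁ isMr)) (cong (r +_) (sym (+-identityʳ r)))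

  no-tensor : ∀ P → ¬ IsTensorProduct U23 N P
  no-tensor P (quasi , rank≡2ρ) =
    <-irrefl (trans rank≡2ρ (cong (rank N +_) (+-identityʳ (rank N))))
             (quasiProduct-rank< {N = N} {P} ¬ingleton quasi)
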